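{- For a semitable $a(x,y,z)$ and natural numbers $m,p,q$: $\models\mathit{Tim}(S^m(0),S^p(0),S^q(0),a(0,0,k),a(\hat0,\tilde0,\tilde k))$ iff $q=m\cdot p$ and $a(x,y,z)$ is an $(m,p)$-semitable.
   Context: First-order predicate calculus with identity $\doteq$ over a language with countably infinitely many function and predicate symbols of every arity; $\models\theta$ means $\theta$ is true in every structure. The language contains distinct constants $0,\hat0,\tilde0,k,\tilde k$, a unary function symbol $S$ and a binary function symbol $\mathrm{pr}$; $S^0(t)=t$, $S^{m+1}(t)=S(S^m(t))$. Fix distinct variables $x,y,z$. Semitables: $z$ is a semitable; if $a(x,y,z)$ is a semitable and $p,q\ge0$, then $\mathrm{pr}(\mathrm{pr}(S^p(x),S^q(y)),a(x,y,z))$ is a semitable. $(m,p)$-semitables: $z$ is an $(m,0)$-semitable; if $a(x,y,z)$ is an $(m,p)$-semitable then $\mathrm{pr}(\mathrm{pr}(S^p(x),S^{m\cdot p}(y)),a(x,y,z))$ is an $(m,p+1)$-semitable. $\mathit{Tim}(x,y,z,w,\tilde w)$ is the semiformula $\hat0\doteq S(0)\wedge\tilde0\doteq x\wedge\tilde k\doteq\mathrm{pr}(\mathrm{pr}(0,0),k)\to\tilde w\doteq\mathrm{pr}(\mathrm{pr}(y,z),w)$. -}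

module Defs where

open import Data.Nat using (ℕ; zero; suc; _*_; _≟_)
open import Data.Vec using (Vec; []; _∷_)
open import Data.Product using (_×_)
open import Data.Empty using (⊥)
open import Relation.Nullary using (yes; no)
open import Relation.Binary.PropositionalEquality using (_≡_)

-- First-order terms over a language with countably many function symbols of
-- every arity: the function symbol (n , i) is the i-th symbol of arity n.
data Term : Set where
  var : ℕ → Term
  fn  : (n i : ℕ) → Vec Term n → Term

data Formula : Set where
  _≐_  : Term → Term → Formula
  rel  : (n i : ℕ) → Vec Term n → Formula
  ⊥'   : Formula
  _⇒_  : Formula → Formula → Formula
  _∧'_ : Formula → Formula → Formula
  ∀'   : ℕ → Formula → Formula

infix  6 _≐_
infixr 5 _∧'_
infixr 4 _⇒_

record Structure : Set₁ where
  field
    Carrier : Set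
    func    : (n i : ℕ) → Vec Carrier n → Carrier
    pred    : (n i : ℕ) → Vec Carrier n → Set

module _ (M : Structure) where
  open Structure M

  mutual
    eval : (ℕ → Carrier) → Term → Carrier
    eval ρ (var v)     = ρ v
    eval ρ (fn n i ts) = func n i (evals ρ ts)

    evals : ∀ {n} → (ℕ → Carrier) → Vec Term n → Vec Carrier n
    evals ρ []       = []
    evals ρ (t ∷ ts) = eval ρ t ∷ evals ρ ts

  update : (ℕ → Carrier) → ℕ → Carrier → ℕ → Carrier
  update ρ v d w with w ≟ v
  ... | yes _ = d
  ... | no  _ = ρ w

  Sat : (ℕ → Carrier) → Formula → Set
  Sat ρ (s ≐ t)      = eval ρ s ≡ eval ρ t
  Sat ρ (rel n i ts) = pred n i (evals ρ ts)
  Sat ρ ⊥'           = ⊥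
  Sat ρ (φ ⇒ ψ)      = Sat ρ φ → Sat ρ ψ
  Sat ρ (φ ∧' ψ)     = Sat ρ φ × Sat ρ ψ
  Sat ρ (∀' v φ)     = (d : Carrier) → Sat (update ρ v d) φ

⊨_ : Formula → Set₁
⊨ θ = (M : Structure) (ρ : ℕ → Structure.Carrier M) → Sat M ρ θ

c0 c0^ c0~ ck ck~ : Term
c0  = fn 0 0 []
c0^ = fn 0 1 []
c0~ = fn 0 2 []
ck  = fn 0 3 []
ck~ = fn 0 4 []

S : Term → Term
S t = fn 1 0 (t ∷ [])

pr : Term → Term → Term
pr s t = fn 2 0 (s ∷ t ∷ [])

S^ : ℕ → Term → Term
S^ zero    t = t
S^ (suc m) t = S (S^ m t)

vx vy vz : Term
vx = var 0
vy = var 1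
vz = var 2

mutual
  subst : (ℕ → Term) → Term → Term
  subst σ (var v)     = σ v
  subst σ (fn n i ts) = fn n i (substs σ ts)

  substs : ∀ {n} → (ℕ → Term) → Vec Term n → Vec Term n
  substs σ []       = []
  substs σ (t ∷ ts) = subst σ t ∷ substs σ ts

sub3 : Term → Term → Term → ℕ → Term
sub3 r s t 0 = r
sub3 r s t 1 = s
sub3 r s t 2 = t
sub3 r s t v = var v

_⟨_,_,_⟩ : Term → Term → Term → Term → Term
a ⟨ r , s , t ⟩ = subst (sub3 r s t) a

data Semitable : Term → Set where
  st-z    : Semitable vz
  st-step : ∀ {a} (p q : ℕ) → Semitable a →
            Semitable (pr (pr (S^ p vx) (S^ q vy)) a)

data MPSemitable (m : ℕ) : ℕ → Term → Set where
  mp-z    : MPSemitable m 0 vz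
  mp-step : ∀ {a p} → MPSemitable m p a →
            MPSemitable m (suc p) (pr (pr (S^ p vx) (S^ (m * p) vy)) a)

-- Tim(x,y,z,w,w~), instantiated at the given terms (it is quantifier-free).
Tim : Term → Term → Term → Term → Term → Formula
Tim x y z w w~ =
  (c0^ ≐ S c0 ∧' c0~ ≐ x ∧' ck~ ≐ pr (pr c0 c0) ck) ⇒ w~ ≐ pr (pr y z) w

module Submission where

-- Put  K = pr(pr(0,0),k)  and call the term
--   table m a = a(S(0), S^m(0), K)
-- the m-table of a.  In any structure satisfying the premise of Tim, the
-- constants 0^, 0~, k~ denote the same elements as S(0), S^m(0), K, so
-- a(0^,0~,k~) and table m a have the same value.  Hence the semantic
-- statement reduces to the purely syntactic equation
--   table m a ≡ pr(pr(S^p(0),S^q(0)), a(0,0,k))                       (*)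
-- in one direction by evaluating (*) in an arbitrary structure, and in the
-- other by evaluating Tim in a term model which interprets 0^, 0~, k~ as
-- S(0), S^m(0), K and every other symbol freely.  Finally, for a semitable
-- a, equation (*) holds iff q = m·p and a is an (m,p)-semitable: peel off
-- one row of the semitable at a time; the row S^p(x),S^q(y) of the table
-- becomes S^(p+1)(0),S^(q+m)(0), which matches the next row of a(0,0,k)
-- exactly when the rows grow like those of an (m,p)-semitable.

open import Defs
open import Data.Nat using (ℕ; zero; suc; _*_; _+_)
open import Data.Nat.Properties using (*-zeroʳ; *-suc; +-comm)
open import Data.Product using (_×_; _,_)
open import Data.Vec using (Vec; []; _∷_)
open import Data.Unit using (⊤)
open import Function.Bundles using (_⇔_; mk⇔)
open import Relation.Binary.PropositionalEquality
  using (_≡_; refl; sym; trans; cong; cong₂; module ≡-Reasoning)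
import Relation.Binary.PropositionalEquality as ≡

subst-S^ : ∀ σ n t → subst σ (S^ n t) ≡ S^ n (subst σ t)
subst-S^ σ zero    t = refl
subst-S^ σ (suc n) t = cong S (subst-S^ σ n t)

S^-+ : ∀ n k t → S^ n (S^ k t) ≡ S^ (n + k) t
S^-+ zero    k t = refl
S^-+ (suc n) k t = cong S (S^-+ n k t)

S-injective : ∀ {s t} → S s ≡ S t → s ≡ t
S-injective refl = refl

S^-injective : ∀ n k → S^ n c0 ≡ S^ k c0 → n ≡ k
S^-injective zero    zero    e = refl
S^-injective (suc n) (suc k) e = cong suc (S^-injective n k (S-injective e))

pr-injective : ∀ {s t s′ t′} → pr s t ≡ pr s′ t′ → s ≡ s′ × t ≡ t′
pr-injective refl = refl , refl

row : ℕ → ℕ → Term → Term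
row p q b = pr (pr (S^ p c0) (S^ q c0)) b

row-injective : ∀ p q p′ q′ {b b′} → row p q b ≡ row p′ q′ b′ →
                p ≡ p′ × q ≡ q′ × b ≡ b′
row-injective p q p′ q′ e with pr-injective e
... | e₁ , e₂ with pr-injective e₁
...   | eₚ , e_q = S^-injective p p′ eₚ , S^-injective q q′ e_q , e₂

step-instance : ∀ p q a r s t →
  pr (pr (S^ p vx) (S^ q vy)) a ⟨ r , s , t ⟩ ≡ pr (pr (S^ p r) (S^ q s)) (a ⟨ r , s , t ⟩)
step-instance p q a r s t =
  cong₂ (λ u v → pr (pr u v) (a ⟨ r , s , t ⟩)) (subst-S^ σ p vx) (subst-S^ σ q vy)
  where σ = sub3 r s t

K : Term
K = pr (pr c0 c0) ck

table : ℕ → Term → Term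
table m a = a ⟨ S c0 , S^ m c0 , K ⟩

table-step : ∀ m p q a →
  table m (pr (pr (S^ p vx) (S^ q vy)) a) ≡ row (suc p) (q + m) (table m a)
table-step m p q a = trans (step-instance p q a (S c0) (S^ m c0) K)
  (cong₂ (λ u v → pr (pr u v) (table m a))
         (trans (S^-+ p 1 c0) (cong (λ n → S^ n c0) (+-comm p 1)))
         (S^-+ q m c0))

mp+m≡m[1+p] : ∀ m p → m * p + m ≡ m * suc p
mp+m≡m[1+p] m p = trans (+-comm (m * p) m) (sym (*-suc m p))

mp-table : ∀ {m p a} → MPSemitable m p a →
           table m a ≡ row p (m * p) (a ⟨ c0 , c0 , ck ⟩)
mp-table {m} mp-z = cong (λ n → row 0 n ck) (sym (*-zeroʳ m))
mp-table {m} (mp-step {a} {p} mp) = begin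
  table m (pr (pr (S^ p vx) (S^ (m * p) vy)) a)
    ≡⟨ table-step m p (m * p) a ⟩
  row (suc p) (m * p + m) (table m a)
    ≡⟨ cong₂ (row (suc p)) (mp+m≡m[1+p] m p) (mp-table mp) ⟩
  row (suc p) (m * suc p) (row p (m * p) (a ⟨ c0 , c0 , ck ⟩))
    ≡⟨ cong (row (suc p) (m * suc p)) (sym (step-instance p (m * p) a c0 c0 ck)) ⟩
  row (suc p) (m * suc p) (pr (pr (S^ p vx) (S^ (m * p) vy)) a ⟨ c0 , c0 , ck ⟩) ∎
  where open ≡-Reasoning

table-mp : ∀ m {a} → Semitable a → ∀ p q →
           table m a ≡ row p q (a ⟨ c0 , c0 , ck ⟩) → q ≡ m * p × MPSemitable m p a
table-mp m st-z p q e with row-injective 0 0 p q e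
... | refl , refl , _ = sym (*-zeroʳ m) , mp-z
table-mp m (st-step {a} p₁ q₁ s) p q e
  with row-injective (suc p₁) (q₁ + m) p q (trans (sym (table-step m p₁ q₁ a))
                     (trans e (cong (row p q) (step-instance p₁ q₁ a c0 c0 ck))))
... | refl , refl , e′ with table-mp m s p₁ q₁ e′
...   | refl , mp = mp+m≡m[1+p] m p₁ , mp-step mp

module _ (M : Structure) (ρ : ℕ → Structure.Carrier M) where
  open Structure M

  mutual
    subst-respects-eval : ∀ σ τ → (∀ v → eval M ρ (σ v) ≡ eval M ρ (τ v)) →
                          ∀ t → eval M ρ (subst σ t) ≡ eval M ρ (subst τ t)
    subst-respects-eval σ τ h (var v)     = h v
    subst-respects-eval σ τ h (fn n i ts) = cong (func n i) (substs-respects-eval σ τ h ts)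

    substs-respects-eval : ∀ σ τ → (∀ v → eval M ρ (σ v) ≡ eval M ρ (τ v)) →
                           ∀ {n} (ts : Vec Term n) →
                           evals M ρ (substs σ ts) ≡ evals M ρ (substs τ ts)
    substs-respects-eval σ τ h []       = refl
    substs-respects-eval σ τ h (t ∷ ts) =
      cong₂ _∷_ (subst-respects-eval σ τ h t) (substs-respects-eval σ τ h ts)

  premise-table : ∀ m a → Sat M ρ (c0^ ≐ S c0 ∧' c0~ ≐ S^ m c0 ∧' ck~ ≐ K) →
                  eval M ρ (a ⟨ c0^ , c0~ , ck~ ⟩) ≡ eval M ρ (table m a)
  premise-table m a (h₀ , h₁ , h₂) =
    subst-respects-eval (sub3 c0^ c0~ ck~) (sub3 (S c0) (S^ m c0) K) agree a
    where
    agree : ∀ v → eval M ρ (sub3 c0^ c0~ ck~ v) ≡ eval M ρ (sub3 (S c0) (S^ m c0) K v)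
    agree 0                   = h₀
    agree 1                   = h₁
    agree 2                   = h₂
    agree (suc (suc (suc v))) = refl

tim-from-table : ∀ m p q a → table m a ≡ row p q (a ⟨ c0 , c0 , ck ⟩) →
  ⊨ Tim (S^ m c0) (S^ p c0) (S^ q c0) (a ⟨ c0 , c0 , ck ⟩) (a ⟨ c0^ , c0~ , ck~ ⟩)
tim-from-table m p q a e M ρ premise =
  trans (premise-table M ρ m a premise) (cong (eval M ρ) e)

module TermModel (m : ℕ) where

  interpret : (n i : ℕ) → Vec Term n → Term
  interpret 0 1 [] = S c0
  interpret 0 2 [] = S^ m c0
  interpret 0 4 [] = K
  interpret n i ts = fn n i ts

  model : Structure
  model = record { Carrier = Term ; func = interpret ; pred = λ _ _ _ → ⊤ }

  Fixed : Term → Set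
  Fixed t = eval model var t ≡ t

  fixed-S^ : ∀ n {t} → Fixed t → Fixed (S^ n t)
  fixed-S^ zero    f = f
  fixed-S^ (suc n) f = cong S (fixed-S^ n f)

  fixed-pr : ∀ {s t} → Fixed s → Fixed t → Fixed (pr s t)
  fixed-pr = cong₂ pr

  fixed-instance : ∀ {a r s t} → Semitable a → Fixed r → Fixed s → Fixed t →
                   Fixed (a ⟨ r , s , t ⟩)
  fixed-instance st-z                fr fs ft = ft
  fixed-instance {r = r} {s} {t} (st-step {a} p q sa) fr fs ft =
    ≡.subst Fixed (sym (step-instance p q a r s t))
      (fixed-pr (fixed-pr (fixed-S^ p fr) (fixed-S^ q fs)) (fixed-instance sa fr fs ft))

  table-from-tim : ∀ p q {a} → Semitable a →
    ⊨ Tim (S^ m c0) (S^ p c0) (S^ q c0) (a ⟨ c0 , c0 , ck ⟩) (a ⟨ c0^ , c0~ , ck~ ⟩) →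
    table m a ≡ row p q (a ⟨ c0 , c0 , ck ⟩)
  table-from-tim p q {a} s valid = begin
    table m a                               ≡⟨ sym fixed-table ⟩
    eval model var (table m a)              ≡⟨ sym (premise-table model var m a premise) ⟩
    eval model var (a ⟨ c0^ , c0~ , ck~ ⟩)  ≡⟨ valid model var premise ⟩
    eval model var (row p q (a ⟨ c0 , c0 , ck ⟩)) ≡⟨ fixed-row ⟩
    row p q (a ⟨ c0 , c0 , ck ⟩)            ∎
    where
    open ≡-Reasoning
    numeral : ∀ n → Fixed (S^ n c0)
    numeral n = fixed-S^ n refl
    premise : Sat model var (c0^ ≐ S c0 ∧' c0~ ≐ S^ m c0 ∧' ck~ ≐ K)
    premise = refl , sym (numeral m) , refl
    fixed-table : Fixed (table m a)
    fixed-table = fixed-instance s (numeral 1) (numeral m) refl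
    fixed-row : Fixed (row p q (a ⟨ c0 , c0 , ck ⟩))
    fixed-row = fixed-pr (fixed-pr (numeral p) (numeral q)) (fixed-instance s refl refl refl)

lemma5p17 : (a : Term) → Semitable a → (m p q : ℕ) →
    (⊨ Tim (S^ m c0) (S^ p c0) (S^ q c0) (a ⟨ c0 , c0 , ck ⟩) (a ⟨ c0^ , c0~ , ck~ ⟩))
    ⇔ (q ≡ m * p × MPSemitable m p a)
lemma5p17 a s m p q = mk⇔
  (λ valid → table-mp m s p q (TermModel.table-from-tim m p q s valid))
  (λ { (refl , mp) → tim-from-table m p (m * p) a (mp-table mp) })
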